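{- There is exactly one Type-II-$T$-sls-pencil and there are exactly $q-2$ Type-III-$T$-sls-pencils. Moreover: (1) if $q$ is even, the Type-II-$T$-sls-pencil meets the line $m_T$ in a Type-II-$T$-sls, and each Type-III-$T$-sls-pencil meets $m_T$ in a Type-III-$T$-sls; (2) if $q$ is odd, the Type-II-$T$-sls-pencil meets $m_T$ in a Type-III-$T$-sls, one Type-III-$T$-sls-pencil meets $m_T$ in a Type-II-$T$-sls, and $q-3$ Type-III-$T$-sls-pencils meet $m_T$ in a Type-III-$T$-sls.
   Context: Let $q$ be a prime power, $\mathbb{F}_{q^3}^*=\mathbb{F}_{q^3}\setminus\{0\}$. Points of $\mathrm{PG}(2,q^3)$ have coordinates $(x,y,z)$, lines $[a,b,c]$, incidence iff $ax+by+cz=0$. Let $\phi$ be the collineation $(x,y,z)\mapsto(z^q,x^q,y^q)$ (on lines $[d,e,f]\mapsto[f^q,d^q,e^q]$). A point has Type I, II or III according as its $\phi$-orbit is a single point, three collinear points, or three non-collinear points; a line has Type I, II or III according as its $\phi$-orbit is one line, three concurrent lines, or three non-concurrent lines. Let $T=(0,0,1)$, $T^\phi=(1,0,0)$, $T^{\phi^2}=(0,1,0)$, and $m_T=[0,0,1]$ the line $T^\phi T^{\phi^2}$. Let $\mathsf S_T=\{\psi_t: t\in\mathbb{F}_{q^3}^*\}$ with $\psi_t\colon(x,y,z)\mapsto(tx,t^qy,t^{q^2}z)$. A $T$-sls is an orbit of $\mathsf S_T$ on the points of $m_T$ other than $T^\phi,T^{\phi^2}$ (these are the $q-1$ sets $\{(x\theta,x^q,0):x\in\mathbb{F}_{q^3}^*\}$,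 $\theta\in\mathbb{F}_{q^3}^*$); all its points have the same Type, and it is a Type-X-$T$-sls if they all have Type X. For a $T$-sls $\mathcal S$, the $T$-sls-pencil $T\mathcal S$ is the set of lines $\{TX:X\in\mathcal S\}$; all its lines have the same Type, and it is a Type-X-$T$-sls-pencil if they all have Type X. -}

module Defs where

open import Level using (0ℓ)
open import Data.Nat as ℕ using (ℕ; zero; suc; _≤_)
open import Data.Nat.Primality using (Prime)
open import Data.Fin using (Fin)
open import Data.Product using (Σ; ∃; _×_; _,_)
open import Relation.Nullary using (¬_)
open import Relation.Binary.PropositionalEquality using (_≡_; _≢_)
open import Algebra.Structures using (IsCommutativeRing)
open import Function.Bundles using (_↔_; _⇔_)

IsPrimePower : ℕ → Set
IsPrimePower q = ∃ λ p → ∃ λ k → Prime p × 1 ≤ k × q ≡ p ℕ.^ k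

record FiniteField (n : ℕ) : Set₁ where
  infixl 6 _+_
  infixl 7 _*_
  infix 8 -_
  field
    Carrier : Set
    _+_ _*_ : Carrier → Carrier → Carrier
    -_ : Carrier → Carrier
    0# 1# : Carrier
    isCommutativeRing : IsCommutativeRing _≡_ _+_ _*_ -_ 0# 1#
    _⁻¹ : Carrier → Carrier
    inverseʳ : ∀ x → x ≢ 0# → x * (x ⁻¹) ≡ 1#
    0≢1 : 0# ≢ 1#
    card : Carrier ↔ Fin n

-- Geometry of PG(2, K) for K a field of order q^3 (q given).
module Geometry {n : ℕ} (F : FiniteField n) (q : ℕ) where
  open FiniteField F

  K : Set
  K = Carrier

  infixr 8 _^_
  _^_ : K → ℕ → K
  x ^ zero = 1#
  x ^ suc m = x * (x ^ m)

  -- homogeneous coordinate triples (used both for points and lines)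
  Triple : Set
  Triple = K × K × K

  NonZero : Triple → Set
  NonZero P = ¬ (P ≡ (0# , 0# , 0#))

  scale : K → Triple → Triple
  scale c (x , y , z) = (c * x , c * y , c * z)

  infix 4 _∼_
  _∼_ : Triple → Triple → Set
  P ∼ Q = ∃ λ c → c ≢ 0# × Q ≡ scale c P

  Inc : Triple → Triple → Set
  Inc (a , b , c) (x , y , z) = (a * x + b * y) + c * z ≡ 0#

  -- the collineation φ (same formula on points and on lines)
  φ : Triple → Triple
  φ (x , y , z) = (z ^ q , x ^ q , y ^ q)

  Collinear : Triple → Triple → Triple → Set
  Collinear P Q R = ∃ λ ℓ → NonZero ℓ × Inc ℓ P × Inc ℓ Q × Inc ℓ R

  Concurrent : Triple → Triple → Triple → Set
  Concurrent ℓ m k = ∃ λ P → NonZero P × Inc ℓ P × Inc m P × Inc k P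

  -- Types of points (P assumed nonzero)
  PTypeI PTypeII PTypeIII : Triple → Set
  PTypeI P = P ∼ φ P
  PTypeII P = ¬ (P ∼ φ P) × Collinear P (φ P) (φ (φ P))
  PTypeIII P = ¬ Collinear P (φ P) (φ (φ P))

  -- Types of lines (ℓ assumed nonzero)
  LTypeI LTypeII LTypeIII : Triple → Set
  LTypeI ℓ = ℓ ∼ φ ℓ
  LTypeII ℓ = ¬ (ℓ ∼ φ ℓ) × Concurrent ℓ (φ ℓ) (φ (φ ℓ))
  LTypeIII ℓ = ¬ Concurrent ℓ (φ ℓ) (φ (φ ℓ))

  T Tφ Tφ² mT : Triple
  T = (0# , 0# , 1#)
  Tφ = (1# , 0# , 0#)
  Tφ² = (0# , 1# , 0#)
  mT = (0# , 0# , 1#)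

  ψ : K → Triple → Triple
  ψ t (x , y , z) = (t * x , (t ^ q) * y , (t ^ (q ℕ.* q)) * z)

  Base : Triple → Set
  Base X = NonZero X × Inc mT X × ¬ (X ∼ Tφ) × ¬ (X ∼ Tφ²)

  -- Y lies in the T-sls (S_T-orbit) of X
  InSls : Triple → Triple → Set
  InSls X Y = ∃ λ t → t ≢ 0# × Y ∼ ψ t X

  SlsTypeII SlsTypeIII : Triple → Set
  SlsTypeII X = ∀ Y → InSls X Y → PTypeII Y
  SlsTypeIII X = ∀ Y → InSls X Y → PTypeIII Y

  -- ℓ belongs to the T-sls-pencil T S where S is the T-sls of X
  InPencil : Triple → Triple → Set
  InPencil X ℓ = NonZero ℓ × ∃ λ Y → InSls X Y × Inc ℓ T × Inc ℓ Y

  PencilTypeII PencilTypeIII : Triple → Set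
  PencilTypeII X = ∀ ℓ → InPencil X ℓ → LTypeII ℓ
  PencilTypeIII X = ∀ ℓ → InPencil X ℓ → LTypeIII ℓ

  SamePencil : Triple → Triple → Set
  SamePencil X Y = ∀ ℓ → InPencil X ℓ ⇔ InPencil Y ℓ

  -- there are exactly N pencils T S (S the T-sls of a base point X) with property P:
  -- N representatives with P giving pairwise distinct pencils, and every
  -- base point with P gives one of these pencils
  ExactlyPencils : ℕ → (Triple → Set) → Set
  ExactlyPencils N P =
    Σ (Fin N → Triple) λ f →
      (∀ i → Base (f i) × P (f i)) ×
      (∀ i j → SamePencil (f i) (f j) → i ≡ j) ×
      (∀ X → Base X → P X → ∃ λ i → SamePencil X (f i))

module Submission where

-- A point X = (x, y, 0) of m_T with x, y ≠ 0 has φ-orbit (x, y, 0), (0, x^q, y^q), (y^(q²), 0, x^(q²)),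
-- and the determinant of these rows is N x + N y, where N u = u^(1+q+q²) is the norm of F_(q³) over F_q.
-- So X is of Type II if κ X = -1 and of Type III otherwise, where κ X = N (y / x); the same holds for
-- the line [x, y, 0] through T. The map ψ_t multiplies y / x by t^(q-1), an element of norm 1, and by
-- Hilbert 90 every element of norm 1 has this form, so the T-sls, and with them the T-sls-pencils,
-- correspond to the q - 1 values of κ. The line through T and X has ratio κ′ with κ′ κ X = N (-1) = -1,
-- so the pencil of X is of Type II iff κ X = 1, while its sls is of Type II iff κ X = -1; these two
-- conditions coincide exactly when q is even.
--
-- The facts about finite fields are proved from scratch: Fermat's little theorem by permuting the
-- units, and, whenever |F| - 1 = a b, that the roots of y^b = 1 are exactly the a-th powers of units
-- and number b: there are at least b such powers, since each fibre of t ↦ t^a has at most a elements,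
-- and at most b such roots. For (a, b) = (1+q+q², q-1) this makes N onto the (q-1)-th roots of unity;
-- for (a, b) = (q-1, 1+q+q²) it is Hilbert 90.

open import Defs
open import Level using (0ℓ)
open import Algebra.Bundles using (CommutativeRing; CommutativeMonoid)
open import Data.Fin as Fin using (Fin; zero; suc)
open import Data.Nat as ℕ using (ℕ; zero; suc; _∸_; _≤_; z≤n; s≤s; NonZero; NonTrivial; >-nonZero; nonTrivial⇒n>1; nonTrivial⇒nonZero; n>1⇒nonTrivial)
import Data.Nat.Properties as ℕ
open import Data.Nat.DivMod using (m≡m%n+[m/n]*n; m%n<n)
open import Data.Nat.Divisibility using (_∣_; _∣?_; divides; m%n≡0⇒n∣m)
open import Data.Nat.Primality using (prime⇒nonTrivial)
open import Data.Nat.Tactic.RingSolver using (solve-∀)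
open import Data.List using (List; []; _∷_; length; filter; map; foldr; replicate; tabulate; lookup)
open import Data.List.Properties using (filter-notAll; filter-none; length-map; length-replicate; length-tabulate)
open import Data.List.Membership.Propositional using (_∈_; find)
open import Data.List.Membership.Propositional.Properties using (∈-filter⁺; ∈-filter⁻; ∈-map⁻; ∈-lookup; ∈-tabulate⁺)
open import Data.List.Membership.Propositional.Properties.WithK using (unique∧set⇒bag)
open import Data.List.Relation.Binary.BagAndSetEquality using (∼bag⇒↭)
open import Data.List.Relation.Binary.Permutation.Propositional using (_↭_; ↭⇒↭ₛ)
open import Data.List.Relation.Binary.Permutation.Setoid.Properties using (foldr-commMonoid)
open import Data.List.Relation.Binary.Subset.Propositional using (_⊆_)
open import Data.List.Relation.Binary.Subset.Propositional.Properties using (filter-⊆)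
open import Data.List.Relation.Unary.All using (All; []; _∷_)
import Data.List.Relation.Unary.All as All
open import Data.List.Relation.Unary.All.Properties using (all-filter)
open import Data.List.Relation.Unary.AllPairs using (_∷_)
open import Data.List.Relation.Unary.Any using (Any; any?; here; there; index)
import Data.List.Relation.Unary.Any as Any
open import Data.List.Relation.Unary.Any.Properties using (lookup-index)
open import Data.List.Relation.Unary.Unique.Propositional using (Unique)
import Data.List.Relation.Unary.Unique.Propositional.Properties as Unique
open import Data.Product using (∃; _×_; _,_; proj₁; proj₂)
open import Data.Product.Function.NonDependent.Propositional using (_×-⇔_)
open import Data.Sum using (_⊎_; inj₁; inj₂)
open import Function.Base using (_∘_; flip)
open import Function.Bundles using (Inverse; Equivalence; _⇔_; mk⇔)
open import Function.Construct.Composition using (_⇔-∘_)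
open import Function.Construct.Identity using (⇔-id)
open import Function.Construct.Symmetry using (⇔-sym)
open import Function.Properties.Inverse using (↔⇒↣)
open import Relation.Binary.Definitions using (DecidableEquality)
open import Relation.Binary.PropositionalEquality
open import Relation.Nullary using (¬_; yes; no; contradiction)
open import Relation.Nullary.Decidable using (via-injection)
open import Relation.Unary using (Pred; Decidable)
open import Relation.Unary.Properties using (∁?)

module _ {A : Set} where

  open import Data.Nat using (_+_)

  length-filter+length-filter-∁ : ∀ {P : Pred A 0ℓ} (P? : Decidable P) xs →
    length (filter P? xs) + length (filter (∁? P?) xs) ≡ length xs
  length-filter+length-filter-∁ P? [] = refl
  length-filter+length-filter-∁ P? (x ∷ xs) with P? x
  ... | yes _ = cong suc (length-filter+length-filter-∁ P? xs)
  ... | no  _ = trans (ℕ.+-suc _ _) (cong suc (length-filter+length-filter-∁ P? xs))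

  ∈-filter⇔ : ∀ {P : Pred A 0ℓ} (P? : Decidable P) {x xs} → x ∈ xs → (x ∈ filter P? xs ⇔ P x)
  ∈-filter⇔ P? {xs = xs} x∈xs = mk⇔ (λ x∈fxs → proj₂ (∈-filter⁻ P? {xs = xs} x∈fxs)) (∈-filter⁺ P? x∈xs)

  Unique⇒lookup-injective : ∀ {xs : List A} → Unique xs → ∀ i j → lookup xs i ≡ lookup xs j → i ≡ j
  Unique⇒lookup-injective (_ ∷ _)      zero    zero    _ = refl
  Unique⇒lookup-injective (x∉xs ∷ _)   zero    (suc j) x≡xs[j] = contradiction x≡xs[j] (All.lookup x∉xs (∈-lookup j))
  Unique⇒lookup-injective (x∉xs ∷ _)   (suc i) zero    xs[i]≡x = contradiction (sym xs[i]≡x) (All.lookup x∉xs (∈-lookup i))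
  Unique⇒lookup-injective (_ ∷ xs!)    (suc i) (suc j) xs[i]≡xs[j] = cong suc (Unique⇒lookup-injective xs! i j xs[i]≡xs[j])

module UniqueLists {A : Set} (_≟_ : DecidableEquality A) where

  open import Data.Nat using (_+_; _*_)
  open import Data.List.Membership.DecPropositional _≟_ using (_∈?_)

  length-filter-≟ : ∀ {a xs} → Unique xs → a ∈ xs → length (filter (_≟ a) xs) ≡ 1
  length-filter-≟ {xs = x ∷ xs} (x∉xs ∷ _) (here refl) with x ≟ x
  ... | no x≢x = contradiction refl x≢x
  ... | yes _  = cong (suc ∘ length) (filter-none (_≟ x) (All.map (λ x≢y y≡x → x≢y (sym y≡x)) x∉xs))
  length-filter-≟ {a} {x ∷ xs} (x∉xs ∷ xs!) (there a∈xs) with x ≟ a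
  ... | yes refl = contradiction refl (All.lookup x∉xs a∈xs)
  ... | no  _    = length-filter-≟ xs! a∈xs

  length-filter-≢ : ∀ {a xs} → Unique xs → a ∈ xs → length (filter (∁? (_≟ a)) xs) ≡ length xs ∸ 1
  length-filter-≢ {a} {xs} xs! a∈xs = begin
    length rest                                  ≡⟨ ℕ.m+n∸m≡n 1 _ ⟨
    1 + length rest ∸ 1                          ≡⟨ cong (λ k → k + length rest ∸ 1) (length-filter-≟ xs! a∈xs) ⟨
    length (filter (_≟ a) xs) + length rest ∸ 1  ≡⟨ cong (_∸ 1) (length-filter+length-filter-∁ (_≟ a) xs) ⟩
    length xs ∸ 1                                ∎
    where
    open ≡-Reasoning
    rest : List A
    rest = filter (∁? (_≟ a)) xs

  Unique∧⊆⇒length≤ : ∀ {xs ys} → Unique xs → xs ⊆ ys → length xs ≤ length ys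
  Unique∧⊆⇒length≤ {[]} _ _ = z≤n
  Unique∧⊆⇒length≤ {x ∷ xs} {ys} (x∉xs ∷ xs!) x∷xs⊆ys = ℕ.≤-trans
    (s≤s (Unique∧⊆⇒length≤ xs! xs⊆ys-x))
    (filter-notAll (∁? (_≟ x)) ys (Any.map (λ x≡y ¬y≢x → ¬y≢x (sym x≡y)) (x∷xs⊆ys (here refl))))
    where
    xs⊆ys-x : xs ⊆ filter (∁? (_≟ x)) ys
    xs⊆ys-x y∈xs = ∈-filter⁺ (∁? (_≟ x)) (x∷xs⊆ys (there y∈xs)) (λ y≡x → All.lookup x∉xs y∈xs (sym y≡x))

  Unique∧⊆∧length≥⇒⊇ : ∀ {xs ys} → Unique xs → xs ⊆ ys → length ys ≤ length xs → ys ⊆ xs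
  Unique∧⊆∧length≥⇒⊇ {xs} {ys} xs! xs⊆ys |ys|≤|xs| {y} y∈ys with y ∈? xs
  ... | yes y∈xs = y∈xs
  ... | no  y∉xs = contradiction |ys|≤|xs| (ℕ.<⇒≱ (Unique∧⊆⇒length≤ (y∉xs′ ∷ xs!) y∷xs⊆ys))
    where
    y∉xs′ : All (y ≢_) xs
    y∉xs′ = All.tabulate (λ x∈xs y≡x → y∉xs (subst (_∈ xs) (sym y≡x) x∈xs))
    y∷xs⊆ys : (y ∷ xs) ⊆ ys
    y∷xs⊆ys (here refl)  = y∈ys
    y∷xs⊆ys (there x∈xs) = xs⊆ys x∈xs

  Unique∧injective⇒map-↭ : ∀ {xs} {f : A → A} → Unique xs → (∀ {x y} → f x ≡ f y → x ≡ y) →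
    (∀ {x} → x ∈ xs → f x ∈ xs) → map f xs ↭ xs
  Unique∧injective⇒map-↭ {xs} {f} xs! f-inj f-closed =
    ∼bag⇒↭ (unique∧set⇒bag fxs! xs! (mk⇔ fxs⊆xs (Unique∧⊆∧length≥⇒⊇ fxs! fxs⊆xs (ℕ.≤-reflexive (sym (length-map f xs))))))
    where
    fxs! : Unique (map f xs)
    fxs! = Unique.map⁺ f-inj xs!
    fxs⊆xs : map f xs ⊆ xs
    fxs⊆xs y∈fxs with ∈-map⁻ f y∈fxs
    ... | x , x∈xs , refl = f-closed x∈xs

  length≤length*fibre : ∀ {B : Set} {k} (f : B → A) {xs ys} → Unique xs → (∀ {x} → x ∈ xs → f x ∈ ys) →
    (∀ y {zs} → Unique zs → All (λ z → f z ≡ y) zs → length zs ≤ k) →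
    length xs ≤ length ys * k
  length≤length*fibre f {[]} _ _ _ = z≤n
  length≤length*fibre f {x ∷ _} {[]} _ maps-into _ with () ← maps-into (here refl)
  length≤length*fibre {k = k} f {xs} {y ∷ ys} xs! maps-into fibre≤k = begin
    length xs                                              ≡⟨ length-filter+length-filter-∁ (λ x → f x ≟ y) xs ⟨
    length (filter (λ x → f x ≟ y) xs) + length rest       ≤⟨ ℕ.+-mono-≤ fibre-y≤k rest≤ ⟩
    k + length ys * k                                      ∎
    where
    open ℕ.≤-Reasoning
    rest : List _
    rest = filter (∁? (λ x → f x ≟ y)) xs
    fibre-y≤k : length (filter (λ x → f x ≟ y) xs) ≤ k
    fibre-y≤k = fibre≤k y (Unique.filter⁺ (λ x → f x ≟ y) xs!) (all-filter (λ x → f x ≟ y) xs)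
    rest≤ : length rest ≤ length ys * k
    rest≤ = length≤length*fibre f (Unique.filter⁺ (∁? (λ x → f x ≟ y)) xs!) rest-maps-into fibre≤k
      where
      rest-maps-into : ∀ {x} → x ∈ rest → f x ∈ ys
      rest-maps-into x∈rest with ∈-filter⁻ (∁? (λ x → f x ≟ y)) x∈rest
      ... | x∈xs , fx≢y with maps-into x∈xs
      ...   | here fx≡y = contradiction fx≡y fx≢y
      ...   | there fx∈ys = fx∈ys

module FiniteFieldTheory {n : ℕ} (F : FiniteField n) where

  open FiniteField F public

  commutativeRing : CommutativeRing 0ℓ 0ℓ
  commutativeRing = record { isCommutativeRing = isCommutativeRing }

  open CommutativeRing commutativeRing public
    using ( +-identityˡ; +-identityʳ; -‿inverseˡ; -‿inverseʳ
          ; *-assoc; *-comm; *-identityˡ; *-identityʳ; zeroˡ; zeroʳ; distribʳ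
          ; commutativeSemiring; +-isCommutativeMonoid; *-isCommutativeMonoid; +-monoid)
  open import Algebra.Properties.Ring (CommutativeRing.ring commutativeRing) public
    using (-‿distribˡ-*; -‿involutive; -0#≈0#; -1*x≈-x; +-inverseʳ-unique; +-identityˡ-unique; +-cancelˡ; -‿injective)
  open import Algebra.Properties.CommutativeSemigroup (CommutativeMonoid.commutativeSemigroup (CommutativeRing.*-commutativeMonoid commutativeRing)) public
    using (x∙yz≈y∙xz; x∙yz≈z∙yx; xy∙z≈xz∙y; interchange)
  open import Algebra.Properties.CommutativeSemiring.Exp commutativeSemiring public
    using (_^_; ^-homo-*; ^-assocʳ; ^-distrib-*)
  open import Algebra.Properties.Monoid.Mult +-monoid public
    using (×-assocˡ) renaming (_×_ to _·_)
  open import Algebra.Solver.Ring.NaturalCoefficients.Default commutativeSemiring public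
    using (solve; _:+_; _:*_; _:=_; con)
  open ≡-Reasoning

  infix 4 _≟_
  _≟_ : DecidableEquality Carrier
  _≟_ = via-injection (↔⇒↣ card) Fin._≟_

  open UniqueLists _≟_ public

  1≢0 : 1# ≢ 0#
  1≢0 1≡0 = 0≢1 (sym 1≡0)

  inverseˡ : ∀ x → x ≢ 0# → x ⁻¹ * x ≡ 1#
  inverseˡ x x≢0 = trans (*-comm _ _) (inverseʳ x x≢0)

  *-cancelˡ : ∀ {c a b} → c ≢ 0# → c * a ≡ c * b → a ≡ b
  *-cancelˡ {c} {a} {b} c≢0 ca≡cb = begin
    a                ≡⟨ *-identityˡ a ⟨
    1# * a           ≡⟨ cong (_* a) (inverseˡ c c≢0) ⟨
    c ⁻¹ * c * a     ≡⟨ *-assoc _ _ _ ⟩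
    c ⁻¹ * (c * a)   ≡⟨ cong (c ⁻¹ *_) ca≡cb ⟩
    c ⁻¹ * (c * b)   ≡⟨ *-assoc _ _ _ ⟨
    c ⁻¹ * c * b     ≡⟨ cong (_* b) (inverseˡ c c≢0) ⟩
    1# * b           ≡⟨ *-identityˡ b ⟩
    b                ∎

  *-cancelʳ : ∀ {c a b} → c ≢ 0# → a * c ≡ b * c → a ≡ b
  *-cancelʳ {c} {a} {b} c≢0 ac≡bc = *-cancelˡ c≢0 (trans (*-comm c a) (trans ac≡bc (*-comm b c)))

  x*y≡0⇒x≡0⊎y≡0 : ∀ {x y} → x * y ≡ 0# → x ≡ 0# ⊎ y ≡ 0#
  x*y≡0⇒x≡0⊎y≡0 {x} {y} xy≡0 with x ≟ 0#
  ... | yes x≡0 = inj₁ x≡0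
  ... | no  x≢0 = inj₂ (*-cancelˡ x≢0 (trans xy≡0 (sym (zeroʳ x))))

  x≢0∧y≢0⇒x*y≢0 : ∀ {x y} → x ≢ 0# → y ≢ 0# → x * y ≢ 0#
  x≢0∧y≢0⇒x*y≢0 x≢0 y≢0 xy≡0 with x*y≡0⇒x≡0⊎y≡0 xy≡0
  ... | inj₁ x≡0 = x≢0 x≡0
  ... | inj₂ y≡0 = y≢0 y≡0

  x≢0⇒x⁻¹≢0 : ∀ {x} → x ≢ 0# → x ⁻¹ ≢ 0#
  x≢0⇒x⁻¹≢0 {x} x≢0 x⁻¹≡0 = 1≢0 (trans (sym (inverseʳ x x≢0)) (trans (cong (x *_) x⁻¹≡0) (zeroʳ x)))

  -1≢0 : - 1# ≢ 0#
  -1≢0 -1≡0 = 1≢0 (trans (sym (-‿involutive 1#)) (trans (cong -_ -1≡0) -0#≈0#))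

  x≢0⇒x^m≢0 : ∀ {x} m → x ≢ 0# → x ^ m ≢ 0#
  x≢0⇒x^m≢0 zero    _   = 1≢0
  x≢0⇒x^m≢0 (suc m) x≢0 = x≢0∧y≢0⇒x*y≢0 x≢0 (x≢0⇒x^m≢0 m x≢0)

  1^m≡1 : ∀ m → 1# ^ m ≡ 1#
  1^m≡1 zero    = refl
  1^m≡1 (suc m) = trans (*-identityˡ _) (1^m≡1 m)

  0^m≡0 : ∀ m .{{_ : NonZero m}} → 0# ^ m ≡ 0#
  0^m≡0 (suc m) = zeroˡ _

  -1^[1+k*2]≡-1 : ∀ k → (- 1#) ^ (1 ℕ.+ k ℕ.* 2) ≡ - 1#
  -1^[1+k*2]≡-1 k = begin
    - 1# * (- 1#) ^ (k ℕ.* 2)    ≡⟨ cong (λ m → - 1# * (- 1#) ^ m) (ℕ.*-comm k 2) ⟩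
    - 1# * (- 1#) ^ (2 ℕ.* k)    ≡⟨ cong (- 1# *_) (^-assocʳ (- 1#) 2 k) ⟨
    - 1# * ((- 1#) ^ 2) ^ k      ≡⟨ cong (λ x → - 1# * x ^ k) [-1]^2≡1 ⟩
    - 1# * 1# ^ k                ≡⟨ cong (- 1# *_) (1^m≡1 k) ⟩
    - 1# * 1#                    ≡⟨ *-identityʳ _ ⟩
    - 1#                         ∎
    where
    [-1]^2≡1 : (- 1#) ^ 2 ≡ 1#
    [-1]^2≡1 = trans (cong (- 1# *_) (*-identityʳ _)) (trans (-1*x≈-x (- 1#)) (-‿involutive 1#))

  [1+k*2]·1≡1 : 1# + 1# ≡ 0# → ∀ k → (1 ℕ.+ k ℕ.* 2) · 1# ≡ 1#
  [1+k*2]·1≡1 1+1≡0 k = begin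
    1# + (k ℕ.* 2) · 1#   ≡⟨ cong (1# +_) (×-assocˡ 1# k 2) ⟨
    1# + k · (2 · 1#)     ≡⟨ cong (λ x → 1# + k · x) (trans (cong (1# +_) (+-identityʳ 1#)) 1+1≡0) ⟩
    1# + k · 0#           ≡⟨ cong (1# +_) (·0≡0 k) ⟩
    1# + 0#               ≡⟨ +-identityʳ 1# ⟩
    1#                    ∎
    where
    ·0≡0 : ∀ m → m · 0# ≡ 0#
    ·0≡0 zero    = refl
    ·0≡0 (suc m) = trans (+-identityˡ _) (·0≡0 m)

  x*y≡-1⇒[x≡-1⇔y≡1] : ∀ {x y} → x * y ≡ - 1# → (x ≡ - 1# ⇔ y ≡ 1#)
  x*y≡-1⇒[x≡-1⇔y≡1] {x} {y} xy≡-1 = mk⇔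
    (λ x≡-1 → -‿injective (trans (sym (-1*x≈-x y)) (trans (cong (_* y) (sym x≡-1)) xy≡-1)))
    (λ y≡1 → trans (sym (*-identityʳ x)) (trans (cong (x *_) (sym y≡1)) xy≡-1))

  elements : List Carrier
  elements = tabulate (Inverse.from card)

  elements-unique : Unique elements
  elements-unique = Unique.tabulate⁺ λ {i} {j} fromi≡fromj → begin
    i                            ≡⟨ Inverse.strictlyInverseˡ card i ⟨
    Inverse.to card (Inverse.from card i) ≡⟨ cong (Inverse.to card) fromi≡fromj ⟩
    Inverse.to card (Inverse.from card j) ≡⟨ Inverse.strictlyInverseˡ card j ⟩
    j                            ∎

  ∈-elements : ∀ x → x ∈ elements
  ∈-elements x = subst (_∈ elements) (Inverse.strictlyInverseʳ card x) (∈-tabulate⁺ (Inverse.to card x))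

  units : List Carrier
  units = filter (∁? (_≟ 0#)) elements

  units-unique : Unique units
  units-unique = Unique.filter⁺ (∁? (_≟ 0#)) elements-unique

  ∈-units : ∀ {x} → x ≢ 0# → x ∈ units
  ∈-units {x} x≢0 = ∈-filter⁺ (∁? (_≟ 0#)) (∈-elements x) x≢0

  ∈-units⇒≢0 : ∀ {x} → x ∈ units → x ≢ 0#
  ∈-units⇒≢0 x∈units = proj₂ (∈-filter⁻ (∁? (_≟ 0#)) {xs = elements} x∈units)

  length-units : length units ≡ n ∸ 1
  length-units = trans (length-filter-≢ elements-unique (∈-elements 0#)) (cong (_∸ 1) (length-tabulate (Inverse.from card)))

  product : List Carrier → Carrier
  product = foldr _*_ 1#

  sum : List Carrier → Carrier
  sum = foldr _+_ 0#

  product-map-* : ∀ a xs → product (map (a *_) xs) ≡ a ^ length xs * product xs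
  product-map-* a []       = sym (*-identityˡ 1#)
  product-map-* a (x ∷ xs) = begin
    a * x * product (map (a *_) xs)       ≡⟨ cong (a * x *_) (product-map-* a xs) ⟩
    a * x * (a ^ length xs * product xs)  ≡⟨ interchange a x (a ^ length xs) (product xs) ⟩
    a * a ^ length xs * (x * product xs)  ∎

  sum-map-1+ : ∀ xs → sum (map (1# +_) xs) ≡ length xs · 1# + sum xs
  sum-map-1+ []       = sym (+-identityˡ 0#)
  sum-map-1+ (x ∷ xs) = begin
    1# + x + sum (map (1# +_) xs)         ≡⟨ cong (1# + x +_) (sum-map-1+ xs) ⟩
    1# + x + (length xs · 1# + sum xs)    ≡⟨ solve 4 (λ o x m s → (o :+ x) :+ (m :+ s) := (o :+ m) :+ (x :+ s)) refl 1# x (length xs · 1#) (sum xs) ⟩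
    1# + length xs · 1# + (x + sum xs)    ∎

  product≢0 : ∀ {xs} → All (_≢ 0#) xs → product xs ≢ 0#
  product≢0 []            = 1≢0
  product≢0 (x≢0 ∷ xs≢0) = x≢0∧y≢0⇒x*y≢0 x≢0 (product≢0 xs≢0)

  x^[n∸1]≡1 : ∀ {x} → x ≢ 0# → x ^ (n ∸ 1) ≡ 1#
  x^[n∸1]≡1 {x} x≢0 = *-cancelʳ (product≢0 (All.tabulate ∈-units⇒≢0)) (begin
    x ^ (n ∸ 1) * product units       ≡⟨ cong (λ k → x ^ k * product units) length-units ⟨
    x ^ length units * product units  ≡⟨ product-map-* x units ⟨
    product (map (x *_) units)        ≡⟨ foldr-commMonoid (setoid Carrier) *-isCommutativeMonoid (↭⇒↭ₛ x*-permutes) ⟩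
    product units                     ≡⟨ *-identityˡ _ ⟨
    1# * product units                ∎)
    where
    x*-permutes : map (x *_) units ↭ units
    x*-permutes = Unique∧injective⇒map-↭ units-unique (*-cancelˡ x≢0)
      (λ u∈units → ∈-units (x≢0∧y≢0⇒x*y≢0 x≢0 (∈-units⇒≢0 u∈units)))

  n·1≡0 : n · 1# ≡ 0#
  n·1≡0 = +-identityˡ-unique (n · 1#) (sum elements) (begin
    n · 1# + sum elements                ≡⟨ cong (λ k → k · 1# + sum elements) (length-tabulate (Inverse.from card)) ⟨
    length elements · 1# + sum elements  ≡⟨ sum-map-1+ elements ⟨
    sum (map (1# +_) elements)           ≡⟨ foldr-commMonoid (setoid Carrier) +-isCommutativeMonoid (↭⇒↭ₛ 1+-permutes) ⟩
    sum elements                         ∎)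
    where
    1+-permutes : map (1# +_) elements ↭ elements
    1+-permutes = Unique∧injective⇒map-↭ elements-unique (+-cancelˡ 1# _ _) (λ {x} _ → ∈-elements (1# + x))

  -- evalMonic cs is the monic polynomial of degree length cs whose lower coefficients are cs,
  -- constant term first.
  evalMonic : List Carrier → Carrier → Carrier
  evalMonic []       x = 1#
  evalMonic (c ∷ cs) x = c + x * evalMonic cs x

  divideByLinear : List Carrier → Carrier → List Carrier
  divideByLinear []       a = []
  divideByLinear (c ∷ cs) a = evalMonic (c ∷ cs) a ∷ divideByLinear cs a

  length-divideByLinear : ∀ cs a → length (divideByLinear cs a) ≡ length cs
  length-divideByLinear []       a = refl
  length-divideByLinear (c ∷ cs) a = cong suc (length-divideByLinear cs a)

  -- With p = evalMonic (c ∷ cs) and q = evalMonic (divideByLinear cs a): p x = (x - a) q x + p a,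
  -- with a q x moved across so that no subtraction occurs.
  evalMonic-divideByLinear : ∀ c cs a x →
    evalMonic (c ∷ cs) x + a * evalMonic (divideByLinear cs a) x ≡
    x * evalMonic (divideByLinear cs a) x + evalMonic (c ∷ cs) a
  evalMonic-divideByLinear c []        a x =
    solve 3 (λ a c x → (c :+ x :* con 1) :+ a :* con 1 := x :* con 1 :+ (c :+ a :* con 1)) refl a c x
  evalMonic-divideByLinear c (c′ ∷ cs) a x = begin
    c + x * p x + a * (p a + x * q)
      ≡⟨ solve 6 (λ a c x px pa q → c :+ x :* px :+ a :* (pa :+ x :* q) := (c :+ a :* pa) :+ x :* (px :+ a :* q))
           refl a c x (p x) (p a) q ⟩
    c + a * p a + x * (p x + a * q)
      ≡⟨ cong (λ t → c + a * p a + x * t) (evalMonic-divideByLinear c′ cs a x) ⟩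
    c + a * p a + x * (x * q + p a)
      ≡⟨ solve 5 (λ a c x pa q → (c :+ a :* pa) :+ x :* (x :* q :+ pa) := x :* (pa :+ x :* q) :+ (c :+ a :* pa))
           refl a c x (p a) q ⟩
    x * (p a + x * q) + (c + a * p a)
      ∎
    where
    p : Carrier → Carrier
    p = evalMonic (c′ ∷ cs)
    q : Carrier
    q = evalMonic (divideByLinear cs a) x

  roots-bound : ∀ cs {rs} → Unique rs → All (λ r → evalMonic cs r ≡ 0#) rs → length rs ≤ length cs
  roots-bound cs       {[]}     _ _ = z≤n
  roots-bound []       {r ∷ rs} _ (1≡0 ∷ _) = contradiction 1≡0 1≢0
  roots-bound (c ∷ cs) {r ∷ rs} (r∉rs ∷ rs!) (pr≡0 ∷ prs≡0) =
    s≤s (subst (length rs ≤_) (length-divideByLinear cs r)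
      (roots-bound (divideByLinear cs r) rs! (All.zipWith (λ (r≢s , ps≡0) → quotient-vanishes r≢s ps≡0) (r∉rs , prs≡0))))
    where
    quotient-vanishes : ∀ {s} → r ≢ s → evalMonic (c ∷ cs) s ≡ 0# → evalMonic (divideByLinear cs r) s ≡ 0#
    quotient-vanishes {s} r≢s ps≡0 with evalMonic (divideByLinear cs r) s ≟ 0#
    ... | yes qs≡0 = qs≡0
    ... | no  qs≢0 = contradiction (*-cancelʳ qs≢0 (begin
      r * q                     ≡⟨ +-identityˡ _ ⟨
      0# + r * q                ≡⟨ cong (_+ r * q) ps≡0 ⟨
      evalMonic (c ∷ cs) s + r * q ≡⟨ evalMonic-divideByLinear c cs r s ⟩
      s * q + evalMonic (c ∷ cs) r ≡⟨ cong (s * q +_) pr≡0 ⟩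
      s * q + 0#                ≡⟨ +-identityʳ _ ⟩
      s * q                     ∎)) r≢s
      where
      q : Carrier
      q = evalMonic (divideByLinear cs r) s

  x^d≡c-roots-bound : ∀ d .{{_ : NonZero d}} {c rs} → Unique rs → All (λ r → r ^ d ≡ c) rs → length rs ≤ d
  x^d≡c-roots-bound (suc d) {c} {rs} rs! r^d≡c =
    subst (length rs ≤_) (cong suc (length-replicate d)) (roots-bound (- c ∷ replicate d 0#) rs! (All.map root r^d≡c))
    where
    evalMonic-replicate : ∀ m x → evalMonic (replicate m 0#) x ≡ x ^ m
    evalMonic-replicate zero    x = refl
    evalMonic-replicate (suc m) x = trans (+-identityˡ _) (cong (x *_) (evalMonic-replicate m x))
    root : ∀ {r} → r ^ suc d ≡ c → evalMonic (- c ∷ replicate d 0#) r ≡ 0#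
    root {r} r^d≡c = begin
      - c + r * evalMonic (replicate d 0#) r  ≡⟨ cong (λ t → - c + r * t) (evalMonic-replicate d r) ⟩
      - c + r ^ suc d                          ≡⟨ cong (- c +_) r^d≡c ⟩
      - c + c                                  ≡⟨ -‿inverseˡ c ⟩
      0#                                       ∎

  rootsOfUnity : ℕ → List Carrier
  rootsOfUnity b = filter (λ y → y ^ b ≟ 1#) elements

  module _ (a b : ℕ) .{{_ : NonZero a}} .{{_ : NonZero b}} (n∸1≡a*b : n ∸ 1 ≡ a ℕ.* b) where

    private
      isPower? : Decidable (λ y → Any (λ t → t ^ a ≡ y) units)
      isPower? y = any? (λ t → t ^ a ≟ y) units

      powers : List Carrier
      powers = filter isPower? elements

      powers-unique : Unique powers
      powers-unique = Unique.filter⁺ isPower? elements-unique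

      powers⊆rootsOfUnity : powers ⊆ rootsOfUnity b
      powers⊆rootsOfUnity {y} y∈powers with find (proj₂ (∈-filter⁻ isPower? {xs = elements} y∈powers))
      ... | t , t∈units , refl = ∈-filter⁺ (λ y → y ^ b ≟ 1#) (∈-elements _) (begin
        (t ^ a) ^ b    ≡⟨ ^-assocʳ t a b ⟩
        t ^ (a ℕ.* b)  ≡⟨ cong (t ^_) n∸1≡a*b ⟨
        t ^ (n ∸ 1)    ≡⟨ x^[n∸1]≡1 (∈-units⇒≢0 t∈units) ⟩
        1#             ∎)

      b≤|powers| : b ≤ length powers
      b≤|powers| = ℕ.*-cancelʳ-≤ b (length powers) a (subst (_≤ length powers ℕ.* a) |units|≡b*a
        (length≤length*fibre (_^ a) units-unique power∈powers (λ _ → x^d≡c-roots-bound a)))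
        where
        |units|≡b*a : length units ≡ b ℕ.* a
        |units|≡b*a = trans length-units (trans n∸1≡a*b (ℕ.*-comm a b))
        power∈powers : ∀ {t} → t ∈ units → t ^ a ∈ powers
        power∈powers {t} t∈units = ∈-filter⁺ isPower? (∈-elements _) (Any.map (λ t≡s → cong (_^ a) (sym t≡s)) t∈units)

      |rootsOfUnity|≤b : length (rootsOfUnity b) ≤ b
      |rootsOfUnity|≤b = x^d≡c-roots-bound b (Unique.filter⁺ (λ y → y ^ b ≟ 1#) elements-unique) (all-filter (λ y → y ^ b ≟ 1#) elements)

    length-rootsOfUnity : length (rootsOfUnity b) ≡ b
    length-rootsOfUnity = ℕ.≤-antisym |rootsOfUnity|≤b
      (ℕ.≤-trans b≤|powers| (Unique∧⊆⇒length≤ powers-unique powers⊆rootsOfUnity))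

    rootOfUnity⇒power : ∀ {y} → y ^ b ≡ 1# → ∃ λ t → t ≢ 0# × t ^ a ≡ y
    rootOfUnity⇒power {y} y^b≡1 with find (proj₂ (∈-filter⁻ isPower? {xs = elements} y∈powers))
      where
      y∈powers : y ∈ powers
      y∈powers = Unique∧⊆∧length≥⇒⊇ powers-unique powers⊆rootsOfUnity (ℕ.≤-trans |rootsOfUnity|≤b b≤|powers|)
        (∈-filter⁺ (λ y → y ^ b ≟ 1#) (∈-elements y) y^b≡1)
    ... | t , t∈units , t^a≡y = t , ∈-units⇒≢0 t∈units , t^a≡y

module Arithmetic where

  open import Data.Nat using (_+_; _*_; _^_; _%_; _/_)

  m^3∸1≡[m∸1]*[1+m+m*m] : ∀ m → m ^ 3 ∸ 1 ≡ (m ∸ 1) * (1 + m + m * m)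
  m^3∸1≡[m∸1]*[1+m+m*m] zero    = refl
  m^3∸1≡[m∸1]*[1+m+m*m] (suc m) = cong (_∸ 1) (expand m)
    where
    expand : ∀ m → suc m * (suc m * (suc m * 1)) ≡ suc (m * (1 + suc m + suc m * suc m))
    expand = solve-∀

  ¬2∣⇒odd : ∀ {m} → ¬ 2 ∣ m → ∃ λ k → m ≡ 1 + k * 2
  ¬2∣⇒odd {m} ¬2∣m = m / 2 , trans (m≡m%n+[m/n]*n m 2) (cong (_+ m / 2 * 2) m%2≡1)
    where
    m%2≡1 : m % 2 ≡ 1
    m%2≡1 with m % 2 | m%n<n m 2 | m%n≡0⇒n∣m m 2
    ... | 0           | _                 | 2∣m = contradiction (2∣m refl) ¬2∣m
    ... | 1           | _                 | _   = refl
    ... | suc (suc _) | s≤s (s≤s ())      | _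

  1+m+m*m-odd : ∀ m → ∃ λ k → 1 + m + m * m ≡ 1 + k * 2
  1+m+m*m-odd m with 2 ∣? m
  ... | yes (divides k refl) = k + k * k * 2 , even k
    where
    even : ∀ k → 1 + k * 2 + k * 2 * (k * 2) ≡ 1 + (k + k * k * 2) * 2
    even = solve-∀
  ... | no ¬2∣m with ¬2∣⇒odd ¬2∣m
  ...   | k , refl = 1 + 3 * k + 2 * k * k , odd k
    where
    odd : ∀ k → 1 + (1 + k * 2) + (1 + k * 2) * (1 + k * 2) ≡ 1 + (1 + 3 * k + 2 * k * k) * 2
    odd = solve-∀

  odd^3-odd : ∀ k → ∃ λ j → (1 + k * 2) ^ 3 ≡ 1 + j * 2
  odd^3-odd k = 3 * k + 6 * k * k + 4 * k * k * k , expand k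
    where
    expand : ∀ k → (1 + k * 2) * ((1 + k * 2) * ((1 + k * 2) * 1)) ≡ 1 + (3 * k + 6 * k * k + 4 * k * k * k) * 2
    expand = solve-∀

open Arithmetic

module Norm (q : ℕ) .{{_ : NonTrivial q}} (F : FiniteField (q ℕ.^ 3)) where

  open FiniteFieldTheory F public

  normExponent : ℕ
  normExponent = 1 ℕ.+ q ℕ.+ q ℕ.* q

  norm : Carrier → Carrier
  norm x = x ^ normExponent

  instance
    q-nonZero : NonZero q
    q-nonZero = nonTrivial⇒nonZero q

    q∸1-nonZero : NonZero (q ∸ 1)
    q∸1-nonZero = >-nonZero (ℕ.m<n⇒0<n∸m (nonTrivial⇒n>1 q))

  open ≡-Reasoning

  x^q≡x*x^[q∸1] : ∀ x → x ^ q ≡ x * x ^ (q ∸ 1)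
  x^q≡x*x^[q∸1] x = cong (x ^_) (sym (ℕ.m+[n∸m]≡n (ℕ.<⇒≤ (nonTrivial⇒n>1 q))))

  q^3∸1≡[q∸1]*normExponent : q ℕ.^ 3 ∸ 1 ≡ (q ∸ 1) ℕ.* normExponent
  q^3∸1≡[q∸1]*normExponent = m^3∸1≡[m∸1]*[1+m+m*m] q

  norm-* : ∀ x y → norm (x * y) ≡ norm x * norm y
  norm-* x y = ^-distrib-* x y normExponent

  norm≢0 : ∀ {x} → x ≢ 0# → norm x ≢ 0#
  norm≢0 = x≢0⇒x^m≢0 normExponent

  norm^[q∸1]≡1 : ∀ {x} → x ≢ 0# → norm x ^ (q ∸ 1) ≡ 1#
  norm^[q∸1]≡1 {x} x≢0 = begin
    (x ^ normExponent) ^ (q ∸ 1)   ≡⟨ ^-assocʳ x normExponent (q ∸ 1) ⟩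
    x ^ (normExponent ℕ.* (q ∸ 1)) ≡⟨ cong (x ^_) (ℕ.*-comm normExponent (q ∸ 1)) ⟩
    x ^ ((q ∸ 1) ℕ.* normExponent) ≡⟨ cong (x ^_) q^3∸1≡[q∸1]*normExponent ⟨
    x ^ (q ℕ.^ 3 ∸ 1)              ≡⟨ x^[n∸1]≡1 x≢0 ⟩
    1#                             ∎

  norm[x^q]≡norm[x] : ∀ {x} → x ≢ 0# → norm (x ^ q) ≡ norm x
  norm[x^q]≡norm[x] {x} x≢0 = begin
    (x ^ q) ^ normExponent                          ≡⟨ cong (_^ normExponent) (x^q≡x*x^[q∸1] x) ⟩
    (x * x ^ (q ∸ 1)) ^ normExponent                ≡⟨ norm-* x _ ⟩
    norm x * (x ^ (q ∸ 1)) ^ normExponent           ≡⟨ cong (norm x *_) (^-assocʳ x (q ∸ 1) normExponent) ⟩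
    norm x * x ^ ((q ∸ 1) ℕ.* normExponent)         ≡⟨ cong (λ m → norm x * x ^ m) q^3∸1≡[q∸1]*normExponent ⟨
    norm x * x ^ (q ℕ.^ 3 ∸ 1)                      ≡⟨ cong (norm x *_) (x^[n∸1]≡1 x≢0) ⟩
    norm x * 1#                                     ≡⟨ *-identityʳ _ ⟩
    norm x                                          ∎

  norm[-1]≡-1 : norm (- 1#) ≡ - 1#
  norm[-1]≡-1 with 1+m+m*m-odd q
  ... | k , normExponent≡1+k*2 = trans (cong ((- 1#) ^_) normExponent≡1+k*2) (-1^[1+k*2]≡-1 k)

  μ : List Carrier
  μ = rootsOfUnity (q ∸ 1)

  μ-unique : Unique μ
  μ-unique = Unique.filter⁺ (λ y → y ^ (q ∸ 1) ≟ 1#) elements-unique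

  length-μ : length μ ≡ q ∸ 1
  length-μ = length-rootsOfUnity normExponent (q ∸ 1)
    (trans q^3∸1≡[q∸1]*normExponent (ℕ.*-comm (q ∸ 1) normExponent))

  rootOfUnity⇒norm : ∀ {y} → y ^ (q ∸ 1) ≡ 1# → ∃ λ x → x ≢ 0# × norm x ≡ y
  rootOfUnity⇒norm = rootOfUnity⇒power normExponent (q ∸ 1)
    (trans q^3∸1≡[q∸1]*normExponent (ℕ.*-comm (q ∸ 1) normExponent))

  hilbert90 : ∀ {y} → norm y ≡ 1# → ∃ λ x → x ≢ 0# × x ^ (q ∸ 1) ≡ y
  hilbert90 = rootOfUnity⇒power (q ∸ 1) normExponent q^3∸1≡[q∸1]*normExponent

  norm∈μ : ∀ {x} → x ≢ 0# → norm x ∈ μ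
  norm∈μ {x} x≢0 = ∈-filter⁺ (λ y → y ^ (q ∸ 1) ≟ 1#) (∈-elements (norm x)) (norm^[q∸1]≡1 x≢0)

  norm≡norm⇒quotient-is-power : ∀ {x y} → y ≢ 0# → norm x ≡ norm y → ∃ λ t → t ≢ 0# × t ^ (q ∸ 1) * y ≡ x
  norm≡norm⇒quotient-is-power {x} {y} y≢0 Nx≡Ny with hilbert90 norm[x/y]≡1
    where
    norm[x/y]≡1 : norm (x * y ⁻¹) ≡ 1#
    norm[x/y]≡1 = begin
      norm (x * y ⁻¹)       ≡⟨ norm-* x (y ⁻¹) ⟩
      norm x * norm (y ⁻¹)  ≡⟨ cong (_* norm (y ⁻¹)) Nx≡Ny ⟩
      norm y * norm (y ⁻¹)  ≡⟨ norm-* y (y ⁻¹) ⟨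
      norm (y * y ⁻¹)       ≡⟨ cong norm (inverseʳ y y≢0) ⟩
      norm 1#               ≡⟨ 1^m≡1 normExponent ⟩
      1#                    ∎
  ... | t , t≢0 , t^[q∸1]≡x/y = t , t≢0 , (begin
    t ^ (q ∸ 1) * y    ≡⟨ cong (_* y) t^[q∸1]≡x/y ⟩
    x * y ⁻¹ * y       ≡⟨ *-assoc x _ _ ⟩
    x * (y ⁻¹ * y)     ≡⟨ cong (x *_) (inverseˡ y y≢0) ⟩
    x * 1#             ≡⟨ *-identityʳ x ⟩
    x                  ∎)

  2∣q⇒-1≡1 : 2 ∣ q → - 1# ≡ 1#
  2∣q⇒-1≡1 (divides zero q≡0) = contradiction (subst (ℕ._> 1) q≡0 (nonTrivial⇒n>1 q)) λ ()
  2∣q⇒-1≡1 (divides (suc k) q≡[1+k]*2) = begin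
    - 1#                      ≡⟨ -1^[1+k*2]≡-1 k ⟨
    (- 1#) ^ (1 ℕ.+ k ℕ.* 2)  ≡⟨ cong (λ m → (- 1#) ^ (m ∸ 1)) q≡[1+k]*2 ⟨
    (- 1#) ^ (q ∸ 1)          ≡⟨ cong (_^ (q ∸ 1)) norm[-1]≡-1 ⟨
    norm (- 1#) ^ (q ∸ 1)     ≡⟨ norm^[q∸1]≡1 -1≢0 ⟩
    1#                        ∎

  ¬2∣q⇒-1≢1 : ¬ 2 ∣ q → - 1# ≢ 1#
  ¬2∣q⇒-1≢1 ¬2∣q -1≡1 with ¬2∣⇒odd ¬2∣q
  ... | k , q≡1+k*2 with odd^3-odd k
  ...   | j , q^3≡1+j*2 = 0≢1 (begin
    0#                            ≡⟨ n·1≡0 ⟨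
    (q ℕ.^ 3) · 1#                ≡⟨ cong (λ m → (m ℕ.^ 3) · 1#) q≡1+k*2 ⟩
    ((1 ℕ.+ k ℕ.* 2) ℕ.^ 3) · 1#  ≡⟨ cong (_· 1#) q^3≡1+j*2 ⟩
    (1 ℕ.+ j ℕ.* 2) · 1#          ≡⟨ [1+k*2]·1≡1 1+1≡0 j ⟩
    1#                            ∎)
    where
    1+1≡0 : 1# + 1# ≡ 0#
    1+1≡0 = trans (cong (1# +_) (sym -1≡1)) (-‿inverseʳ 1#)

module Pencils (q : ℕ) .{{_ : NonTrivial q}} (F : FiniteField (q ℕ.^ 3)) where

  open Norm q F public
  open Geometry F q hiding (_^_)
  open Geometry F q using () renaming (_^_ to _^ᴳ_)
  open Equivalence using (to; from)
  open ≡-Reasoning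

  ≡⇒⇔ : ∀ {A : Set} (P : A → Set) {a b} → a ≡ b → P a ⇔ P b
  ≡⇒⇔ P refl = ⇔-id _

  ^ᴳ≡^ : ∀ x m → x ^ᴳ m ≡ x ^ m
  ^ᴳ≡^ x zero    = refl
  ^ᴳ≡^ x (suc m) = cong (x *_) (^ᴳ≡^ x m)

  φ≡ : ∀ x y z → φ (x , y , z) ≡ (z ^ q , x ^ q , y ^ q)
  φ≡ x y z = cong₂ _,_ (^ᴳ≡^ z q) (cong₂ _,_ (^ᴳ≡^ x q) (^ᴳ≡^ y q))

  Inc-sym : ∀ ℓ P → Inc ℓ P → Inc P ℓ
  Inc-sym (a , b , c) (x , y , z) ℓ·P≡0 =
    trans (cong₂ _+_ (cong₂ _+_ (*-comm x a) (*-comm y b)) (*-comm z c)) ℓ·P≡0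

  Concurrent⇔Collinear : ∀ ℓ m k → Concurrent ℓ m k ⇔ Collinear ℓ m k
  Concurrent⇔Collinear ℓ m k = mk⇔
    (λ (P , P≢0 , ℓP , mP , kP) → P , P≢0 , Inc-sym ℓ P ℓP , Inc-sym m P mP , Inc-sym k P kP)
    (λ (L , L≢0 , Lℓ , Lm , Lk) → L , L≢0 , Inc-sym L ℓ Lℓ , Inc-sym L m Lm , Inc-sym L k Lk)

  x+y*e≡z*e′+w*e″⇒x≡0 : ∀ {x y z w e e′ e″} → x + y * e ≡ z * e′ + w * e″ → e ≡ 0# → e′ ≡ 0# → e″ ≡ 0# → x ≡ 0#
  x+y*e≡z*e′+w*e″⇒x≡0 {x} {y} {z} {w} eq refl refl refl = begin
    x                  ≡⟨ +-identityʳ x ⟨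
    x + 0#             ≡⟨ cong (x +_) (zeroʳ y) ⟨
    x + y * 0#         ≡⟨ eq ⟩
    z * 0# + w * 0#    ≡⟨ cong₂ _+_ (zeroʳ z) (zeroʳ w) ⟩
    0# + 0#            ≡⟨ +-identityʳ 0# ⟩
    0#                 ∎

  collinear⇒det≡0 : ∀ {a b A B A′ B′} →
    Collinear (a , b , 0#) (0# , A , B) (B′ , 0# , A′) → a * A * A′ + b * B * B′ ≡ 0#
  collinear⇒det≡0 {a} {b} {A} {B} {A′} {B′} ((l₁ , l₂ , l₃) , l≢0 , e₁ , e₂ , e₃) with a * A * A′ + b * B * B′ ≟ 0#
  ... | yes det≡0 = det≡0
  ... | no  det≢0 = contradiction (cong₂ _,_ (l≡0 i₁ e₂ e₁ e₃) (cong₂ _,_ (l≡0 i₂ e₃ e₁ e₂) (l≡0 i₃ e₁ e₂ e₃))) l≢0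
    where
    det : Carrier
    det = a * A * A′ + b * B * B′
    l≡0 : ∀ {l e e′ e″ v w s} → det * l + v * e ≡ w * e′ + s * e″ → e ≡ 0# → e′ ≡ 0# → e″ ≡ 0# → l ≡ 0#
    l≡0 eq e≡0 e′≡0 e″≡0 with x*y≡0⇒x≡0⊎y≡0 (x+y*e≡z*e′+w*e″⇒x≡0 eq e≡0 e′≡0 e″≡0)
    ... | inj₁ det≡0 = contradiction det≡0 det≢0
    ... | inj₂ l≡0   = l≡0
    -- det · lᵢ as a combination of the three incidences: the rows of the adjugate matrix
    i₁ : det * l₁ + (b * A′) * ((l₁ * 0# + l₂ * A) + l₃ * B) ≡
         (A * A′) * ((l₁ * a + l₂ * b) + l₃ * 0#) + (b * B) * ((l₁ * B′ + l₂ * 0#) + l₃ * A′)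
    i₁ = solve 9 (λ a b A B A′ B′ l₁ l₂ l₃ →
           (a :* A :* A′ :+ b :* B :* B′) :* l₁ :+ (b :* A′) :* ((l₁ :* con 0 :+ l₂ :* A) :+ l₃ :* B)
        := (A :* A′) :* ((l₁ :* a :+ l₂ :* b) :+ l₃ :* con 0) :+ (b :* B) :* ((l₁ :* B′ :+ l₂ :* con 0) :+ l₃ :* A′))
        refl a b A B A′ B′ l₁ l₂ l₃
    i₂ : det * l₂ + (a * B) * ((l₁ * B′ + l₂ * 0#) + l₃ * A′) ≡
         (B * B′) * ((l₁ * a + l₂ * b) + l₃ * 0#) + (a * A′) * ((l₁ * 0# + l₂ * A) + l₃ * B)
    i₂ = solve 9 (λ a b A B A′ B′ l₁ l₂ l₃ →
           (a :* A :* A′ :+ b :* B :* B′) :* l₂ :+ (a :* B) :* ((l₁ :* B′ :+ l₂ :* con 0) :+ l₃ :* A′)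
        := (B :* B′) :* ((l₁ :* a :+ l₂ :* b) :+ l₃ :* con 0) :+ (a :* A′) :* ((l₁ :* con 0 :+ l₂ :* A) :+ l₃ :* B))
        refl a b A B A′ B′ l₁ l₂ l₃
    i₃ : det * l₃ + (A * B′) * ((l₁ * a + l₂ * b) + l₃ * 0#) ≡
         (b * B′) * ((l₁ * 0# + l₂ * A) + l₃ * B) + (a * A) * ((l₁ * B′ + l₂ * 0#) + l₃ * A′)
    i₃ = solve 9 (λ a b A B A′ B′ l₁ l₂ l₃ →
           (a :* A :* A′ :+ b :* B :* B′) :* l₃ :+ (A :* B′) :* ((l₁ :* a :+ l₂ :* b) :+ l₃ :* con 0)
        := (b :* B′) :* ((l₁ :* con 0 :+ l₂ :* A) :+ l₃ :* B) :+ (a :* A) :* ((l₁ :* B′ :+ l₂ :* con 0) :+ l₃ :* A′))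
        refl a b A B A′ B′ l₁ l₂ l₃

  det≡0⇒collinear : ∀ {a b A B A′ B′} → a * A ≢ 0# →
    a * A * A′ + b * B * B′ ≡ 0# → Collinear (a , b , 0#) (0# , A , B) (B′ , 0# , A′)
  det≡0⇒collinear {a} {b} {A} {B} {A′} {B′} aA≢0 det≡0 =
    (b * B , m , a * A) , (λ l≡0 → aA≢0 (cong (proj₂ ∘ proj₂) l≡0)) , e₁ , e₂ , e₃
    where
    -- the line is the cross product of the first two rows
    m : Carrier
    m = - (a * B)
    aB+m≡0 : a * B + m ≡ 0#
    aB+m≡0 = -‿inverseʳ (a * B)
    e₁ : (b * B * a + m * b) + a * A * 0# ≡ 0#
    e₁ = begin
      (b * B * a + m * b) + a * A * 0#  ≡⟨ solve 5 (λ a b A B m → (b :* B :* a :+ m :* b) :+ a :* A :* con 0 := (a :* B :+ m) :* b) refl a b A B m ⟩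
      (a * B + m) * b                   ≡⟨ cong (_* b) aB+m≡0 ⟩
      0# * b                            ≡⟨ zeroˡ b ⟩
      0#                                ∎
    e₂ : (b * B * 0# + m * A) + a * A * B ≡ 0#
    e₂ = begin
      (b * B * 0# + m * A) + a * A * B  ≡⟨ solve 5 (λ a b A B m → (b :* B :* con 0 :+ m :* A) :+ a :* A :* B := (a :* B :+ m) :* A) refl a b A B m ⟩
      (a * B + m) * A                   ≡⟨ cong (_* A) aB+m≡0 ⟩
      0# * A                            ≡⟨ zeroˡ A ⟩
      0#                                ∎
    e₃ : (b * B * B′ + m * 0#) + a * A * A′ ≡ 0#
    e₃ = trans (solve 7 (λ a b A B A′ B′ m → (b :* B :* B′ :+ m :* con 0) :+ a :* A :* A′ := a :* A :* A′ :+ b :* B :* B′)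
                 refl a b A B A′ B′ m)
               det≡0

  collinear⇔det≡0 : ∀ {a b A B A′ B′} → a * A ≢ 0# →
    Collinear (a , b , 0#) (0# , A , B) (B′ , 0# , A′) ⇔ a * A * A′ + b * B * B′ ≡ 0#
  collinear⇔det≡0 aA≢0 = mk⇔ collinear⇒det≡0 (det≡0⇒collinear aA≢0)

  -- The coordinates of the points of m_T other than T^φ, T^φ² (see Base⇔Generic) and, dually, of the
  -- lines through T other than TT^φ, TT^φ².
  Generic : Triple → Set
  Generic (x , y , z) = z ≡ 0# × x ≢ 0# × y ≢ 0#

  Base⇔Generic : ∀ X → Base X ⇔ Generic X
  Base⇔Generic (x , y , z) = mk⇔ base⇒generic generic⇒base
    where
    base⇒generic : Base (x , y , z) → Generic (x , y , z)
    base⇒generic (X≢0 , X∈mT , X≁Tφ , X≁Tφ²) = z≡0 , x≢0 , y≢0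
      where
      z≡0 : z ≡ 0#
      z≡0 = begin
        z                                  ≡⟨ *-identityˡ z ⟨
        1# * z                             ≡⟨ +-identityˡ _ ⟨
        0# + 1# * z                        ≡⟨ cong (_+ 1# * z) (trans (cong₂ _+_ (zeroˡ x) (zeroˡ y)) (+-identityʳ 0#)) ⟨
        (0# * x + 0# * y) + 1# * z         ≡⟨ X∈mT ⟩
        0#                                 ∎
      scaled : ∀ {c} → c ≢ 0# → ∀ {u v} → c * x ≡ u → c * y ≡ v → (x , y , z) ∼ (u , v , 0#)
      scaled {c} c≢0 cx≡u cy≡v = c , c≢0 , sym (cong₂ _,_ cx≡u (cong₂ _,_ cy≡v (trans (cong (c *_) z≡0) (zeroʳ c))))
      x≢0 : x ≢ 0#
      x≢0 x≡0 with y ≟ 0#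
      ... | yes y≡0 = X≢0 (cong₂ _,_ x≡0 (cong₂ _,_ y≡0 z≡0))
      ... | no  y≢0 = X≁Tφ² (scaled (x≢0⇒x⁻¹≢0 y≢0) (trans (cong (y ⁻¹ *_) x≡0) (zeroʳ _)) (inverseˡ y y≢0))
      y≢0 : y ≢ 0#
      y≢0 y≡0 = X≁Tφ (scaled (x≢0⇒x⁻¹≢0 x≢0) (inverseˡ x x≢0) (trans (cong (x ⁻¹ *_) y≡0) (zeroʳ _)))

    generic⇒base : Generic (x , y , z) → Base (x , y , z)
    generic⇒base (refl , x≢0 , y≢0) = (λ X≡0 → x≢0 (cong proj₁ X≡0)) , X∈mT , X≁Tφ , X≁Tφ²
      where
      X∈mT : (0# * x + 0# * y) + 1# * 0# ≡ 0#
      X∈mT = trans (cong₂ _+_ (trans (cong₂ _+_ (zeroˡ x) (zeroˡ y)) (+-identityʳ 0#)) (zeroʳ 1#)) (+-identityʳ 0#)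
      X≁Tφ : ¬ ((x , y , 0#) ∼ Tφ)
      X≁Tφ (c , c≢0 , Tφ≡cX) = x≢0∧y≢0⇒x*y≢0 c≢0 y≢0 (sym (cong (proj₁ ∘ proj₂) Tφ≡cX))
      X≁Tφ² : ¬ ((x , y , 0#) ∼ Tφ²)
      X≁Tφ² (c , c≢0 , Tφ²≡cX) = x≢0∧y≢0⇒x*y≢0 c≢0 x≢0 (sym (cong proj₁ Tφ²≡cX))

  normRatio : Triple → Carrier
  normRatio (x , y , _) = norm (y * x ⁻¹)

  norm≡normRatio*norm : ∀ {x y z} → x ≢ 0# → norm y ≡ normRatio (x , y , z) * norm x
  norm≡normRatio*norm {x} {y} x≢0 = begin
    norm y                       ≡⟨ cong norm (*-identityʳ y) ⟨
    norm (y * 1#)                ≡⟨ cong (λ u → norm (y * u)) (inverseˡ x x≢0) ⟨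
    norm (y * (x ⁻¹ * x))        ≡⟨ cong norm (*-assoc y _ _) ⟨
    norm (y * x ⁻¹ * x)          ≡⟨ norm-* _ x ⟩
    norm (y * x ⁻¹) * norm x     ∎

  normRatio-unique : ∀ {x y z v} → x ≢ 0# → norm y ≡ v * norm x → normRatio (x , y , z) ≡ v
  normRatio-unique {z = z} x≢0 Ny≡vNx = *-cancelʳ (norm≢0 x≢0) (trans (sym (norm≡normRatio*norm {z = z} x≢0)) Ny≡vNx)

  normRatio∈μ : ∀ {X} → Generic X → normRatio X ∈ μ
  normRatio∈μ {x , y , z} (_ , x≢0 , y≢0) = norm∈μ (x≢0∧y≢0⇒x*y≢0 y≢0 (x≢0⇒x⁻¹≢0 x≢0))

  norm+norm≡0⇔normRatio≡-1 : ∀ {x y z} → x ≢ 0# → norm x + norm y ≡ 0# ⇔ normRatio (x , y , z) ≡ - 1#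
  norm+norm≡0⇔normRatio≡-1 {x} {y} {z} x≢0 = mk⇔
    (λ sum≡0 → +-inverseʳ-unique 1# κ (*-cancelʳ (norm≢0 x≢0) (trans (sym sum≡[1+κ]Nx) (trans sum≡0 (sym (zeroˡ _))))))
    (λ κ≡-1 → trans sum≡[1+κ]Nx (trans (cong (λ k → (1# + k) * norm x) κ≡-1) (trans (cong (_* norm x) (-‿inverseʳ 1#)) (zeroˡ _))))
    where
    κ : Carrier
    κ = normRatio (x , y , z)
    sum≡[1+κ]Nx : norm x + norm y ≡ (1# + κ) * norm x
    sum≡[1+κ]Nx = begin
      norm x + norm y                ≡⟨ cong₂ _+_ (*-identityˡ _) (sym (norm≡normRatio*norm {z = z} x≢0)) ⟨
      1# * norm x + κ * norm x       ≡⟨ distribʳ _ 1# κ ⟨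
      (1# + κ) * norm x              ∎

  φ-orbit : ∀ x y → φ (x , y , 0#) ≡ (0# , x ^ q , y ^ q)
  φ-orbit x y = trans (φ≡ x y 0#) (cong (_, x ^ q , y ^ q) (0^m≡0 q))

  φ²-orbit : ∀ x y → φ (φ (x , y , 0#)) ≡ ((y ^ q) ^ q , 0# , (x ^ q) ^ q)
  φ²-orbit x y = trans (cong φ (φ-orbit x y)) (trans (φ≡ 0# (x ^ q) (y ^ q)) (cong (λ u → (y ^ q) ^ q , u , (x ^ q) ^ q) (0^m≡0 q)))

  x*x^q*[x^q]^q≡norm : ∀ x → x * x ^ q * (x ^ q) ^ q ≡ norm x
  x*x^q*[x^q]^q≡norm x = trans (cong (x * x ^ q *_) (^-assocʳ x q q)) (sym (^-homo-* x (1 ℕ.+ q) (q ℕ.* q)))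

  orbit-collinear⇔ : ∀ {P} → Generic P → Collinear P (φ P) (φ (φ P)) ⇔ normRatio P ≡ - 1#
  orbit-collinear⇔ {x , y , _} (refl , x≢0 , _) =
    norm+norm≡0⇔normRatio≡-1 {z = 0#} x≢0
      ⇔-∘ (≡⇒⇔ (_≡ 0#) (cong₂ _+_ (x*x^q*[x^q]^q≡norm x) (x*x^q*[x^q]^q≡norm y))
      ⇔-∘ (collinear⇔det≡0 (x≢0∧y≢0⇒x*y≢0 x≢0 (x≢0⇒x^m≢0 q x≢0))
      ⇔-∘ ≡⇒⇔ (λ (Q , R) → Collinear (x , y , 0#) Q R) (cong₂ _,_ (φ-orbit x y) (φ²-orbit x y))))

  ¬φ-fixed : ∀ {P} → Generic P → ¬ (P ∼ φ P)
  ¬φ-fixed {x , y , _} (refl , x≢0 , _) (c , c≢0 , φP≡cP) =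
    x≢0∧y≢0⇒x*y≢0 c≢0 x≢0 (trans (sym (cong proj₁ φP≡cP)) (cong proj₁ (φ-orbit x y)))

  PTypeII⇔ : ∀ {P} → Generic P → PTypeII P ⇔ normRatio P ≡ - 1#
  PTypeII⇔ gP = mk⇔ (λ (_ , col) → to (orbit-collinear⇔ gP) col)
    (λ κ≡-1 → ¬φ-fixed gP , from (orbit-collinear⇔ gP) κ≡-1)

  PTypeIII⇔ : ∀ {P} → Generic P → PTypeIII P ⇔ normRatio P ≢ - 1#
  PTypeIII⇔ gP = mk⇔ (λ ¬col κ≡-1 → ¬col (from (orbit-collinear⇔ gP) κ≡-1))
    (λ κ≢-1 col → κ≢-1 (to (orbit-collinear⇔ gP) col))

  orbit-concurrent⇔ : ∀ {ℓ} → Generic ℓ → Concurrent ℓ (φ ℓ) (φ (φ ℓ)) ⇔ normRatio ℓ ≡ - 1#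
  orbit-concurrent⇔ {ℓ} gℓ = orbit-collinear⇔ gℓ ⇔-∘ Concurrent⇔Collinear ℓ (φ ℓ) (φ (φ ℓ))

  LTypeII⇔ : ∀ {ℓ} → Generic ℓ → LTypeII ℓ ⇔ normRatio ℓ ≡ - 1#
  LTypeII⇔ gℓ = mk⇔ (λ (_ , conc) → to (orbit-concurrent⇔ gℓ) conc)
    (λ κ≡-1 → ¬φ-fixed gℓ , from (orbit-concurrent⇔ gℓ) κ≡-1)

  LTypeIII⇔ : ∀ {ℓ} → Generic ℓ → LTypeIII ℓ ⇔ normRatio ℓ ≢ - 1#
  LTypeIII⇔ gℓ = mk⇔ (λ ¬conc κ≡-1 → ¬conc (from (orbit-concurrent⇔ gℓ) κ≡-1))
    (λ κ≢-1 conc → κ≢-1 (to (orbit-concurrent⇔ gℓ) conc))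

  InSls⇒ : ∀ {X Y} → Generic X → InSls X Y → Generic Y × normRatio Y ≡ normRatio X
  InSls⇒ {x , y , _} {y₁ , y₂ , y₃} (refl , x≢0 , y≢0) (t , t≢0 , c , c≢0 , ψtX≡cY) =
    (y₃≡0 , y₁≢0 , y₂≢0) , normRatio-unique {z = y₃} y₁≢0 Ny₂≡κNy₁
    where
    κ : Carrier
    κ = normRatio (x , y , 0#)
    tx≡cy₁ : t * x ≡ c * y₁
    tx≡cy₁ = cong proj₁ ψtX≡cY
    tᵠy≡cy₂ : t ^ q * y ≡ c * y₂
    tᵠy≡cy₂ = trans (cong (_* y) (sym (^ᴳ≡^ t q))) (cong (proj₁ ∘ proj₂) ψtX≡cY)
    y₃≡0 : y₃ ≡ 0#
    y₃≡0 = *-cancelˡ c≢0 (trans (sym (cong (proj₂ ∘ proj₂) ψtX≡cY)) (trans (zeroʳ _) (sym (zeroʳ c))))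
    y₁≢0 : y₁ ≢ 0#
    y₁≢0 y₁≡0 = x≢0∧y≢0⇒x*y≢0 t≢0 x≢0 (trans tx≡cy₁ (trans (cong (c *_) y₁≡0) (zeroʳ c)))
    y₂≢0 : y₂ ≢ 0#
    y₂≢0 y₂≡0 = x≢0∧y≢0⇒x*y≢0 (x≢0⇒x^m≢0 q t≢0) y≢0 (trans tᵠy≡cy₂ (trans (cong (c *_) y₂≡0) (zeroʳ c)))
    Ny₂≡κNy₁ : norm y₂ ≡ κ * norm y₁
    Ny₂≡κNy₁ = *-cancelˡ (norm≢0 c≢0) (begin
      norm c * norm y₂              ≡⟨ norm-* c y₂ ⟨
      norm (c * y₂)                 ≡⟨ cong norm tᵠy≡cy₂ ⟨
      norm (t ^ q * y)              ≡⟨ norm-* _ y ⟩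
      norm (t ^ q) * norm y         ≡⟨ cong₂ _*_ (norm[x^q]≡norm[x] t≢0) (norm≡normRatio*norm {z = 0#} x≢0) ⟩
      norm t * (κ * norm x)         ≡⟨ x∙yz≈y∙xz (norm t) κ (norm x) ⟩
      κ * (norm t * norm x)         ≡⟨ cong (κ *_) (norm-* t x) ⟨
      κ * norm (t * x)              ≡⟨ cong (λ u → κ * norm u) tx≡cy₁ ⟩
      κ * norm (c * y₁)             ≡⟨ cong (κ *_) (norm-* c y₁) ⟩
      κ * (norm c * norm y₁)        ≡⟨ x∙yz≈y∙xz κ (norm c) (norm y₁) ⟩
      norm c * (κ * norm y₁)        ∎)

  InSls⇐ : ∀ {X Y} → Generic X → Generic Y → normRatio Y ≡ normRatio X → InSls X Y
  InSls⇐ {x , y , _} {y₁ , y₂ , _} (refl , x≢0 , y≢0) (refl , y₁≢0 , y₂≢0) κY≡κ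
    with norm≡norm⇒quotient-is-power (x≢0∧y≢0⇒x*y≢0 y₁≢0 y≢0) Nxy₂≡Ny₁y
    where
    κ : Carrier
    κ = normRatio (x , y , 0#)
    Nxy₂≡Ny₁y : norm (x * y₂) ≡ norm (y₁ * y)
    Nxy₂≡Ny₁y = begin
      norm (x * y₂)                   ≡⟨ norm-* x y₂ ⟩
      norm x * norm y₂                ≡⟨ cong (norm x *_) (norm≡normRatio*norm {z = 0#} y₁≢0) ⟩
      norm x * (normRatio (y₁ , y₂ , 0#) * norm y₁) ≡⟨ cong (λ k → norm x * (k * norm y₁)) κY≡κ ⟩
      norm x * (κ * norm y₁)          ≡⟨ x∙yz≈z∙yx (norm x) κ (norm y₁) ⟩
      norm y₁ * (κ * norm x)          ≡⟨ cong (norm y₁ *_) (norm≡normRatio*norm {z = 0#} x≢0) ⟨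
      norm y₁ * norm y                ≡⟨ norm-* y₁ y ⟨
      norm (y₁ * y)                   ∎
  ... | t , t≢0 , t^[q∸1]y₁y≡xy₂ = t , t≢0 , c , c≢0 , cong₂ _,_ tx≡cy₁ (cong₂ _,_ tᵠy≡cy₂ (trans (zeroʳ _) (sym (zeroʳ c))))
    where
    c : Carrier
    c = t * x * y₁ ⁻¹
    c≢0 : c ≢ 0#
    c≢0 = x≢0∧y≢0⇒x*y≢0 (x≢0∧y≢0⇒x*y≢0 t≢0 x≢0) (x≢0⇒x⁻¹≢0 y₁≢0)
    cy₁≡tx : c * y₁ ≡ t * x
    cy₁≡tx = trans (*-assoc _ _ _) (trans (cong (t * x *_) (inverseˡ y₁ y₁≢0)) (*-identityʳ _))
    tx≡cy₁ : t * x ≡ c * y₁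
    tx≡cy₁ = sym cy₁≡tx
    tᵠy≡cy₂ : t ^ᴳ q * y ≡ c * y₂
    tᵠy≡cy₂ = *-cancelʳ y₁≢0 (begin
      t ^ᴳ q * y * y₁                   ≡⟨ cong (λ u → u * y * y₁) (trans (^ᴳ≡^ t q) (x^q≡x*x^[q∸1] t)) ⟩
      t * t ^ (q ∸ 1) * y * y₁          ≡⟨ solve 4 (λ t s y y₁ → t :* s :* y :* y₁ := t :* (s :* (y₁ :* y))) refl t (t ^ (q ∸ 1)) y y₁ ⟩
      t * (t ^ (q ∸ 1) * (y₁ * y))      ≡⟨ cong (t *_) t^[q∸1]y₁y≡xy₂ ⟩
      t * (x * y₂)                      ≡⟨ *-assoc t x y₂ ⟨
      t * x * y₂                        ≡⟨ cong (_* y₂) cy₁≡tx ⟨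
      c * y₁ * y₂                       ≡⟨ xy∙z≈xz∙y c y₁ y₂ ⟩
      c * y₂ * y₁                       ∎)

  InSls⇔ : ∀ {X Y} → Generic X → InSls X Y ⇔ (Generic Y × normRatio Y ≡ normRatio X)
  InSls⇔ gX = mk⇔ (InSls⇒ gX) (λ (gY , κY≡κX) → InSls⇐ gX gY κY≡κX)

  InSls-transfer : ∀ {X X′ Y} → Generic X → Generic X′ → normRatio X ≡ normRatio X′ → InSls X Y → InSls X′ Y
  InSls-transfer gX gX′ κX≡κX′ Y∈slsX with to (InSls⇔ gX) Y∈slsX
  ... | gY , κY≡κX = from (InSls⇔ gX′) (gY , trans κY≡κX κX≡κX′)

  incident⇒normRatio*normRatio≡-1 : ∀ {a b y₁ y₂} → a ≢ 0# → y₁ ≢ 0# → a * y₁ + b * y₂ ≡ 0# →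
    normRatio (a , b , 0#) * normRatio (y₁ , y₂ , 0#) ≡ - 1#
  incident⇒normRatio*normRatio≡-1 {a} {b} {y₁} {y₂} a≢0 y₁≢0 ay₁+by₂≡0 = begin
    norm (b * a ⁻¹) * norm (y₂ * y₁ ⁻¹)               ≡⟨ norm-* _ _ ⟨
    norm (b * a ⁻¹ * (y₂ * y₁ ⁻¹))                    ≡⟨ cong norm (interchange b (a ⁻¹) y₂ (y₁ ⁻¹)) ⟩
    norm (b * y₂ * (a ⁻¹ * y₁ ⁻¹))                    ≡⟨ cong (λ u → norm (u * (a ⁻¹ * y₁ ⁻¹))) by₂≡-ay₁ ⟩
    norm (- (a * y₁) * (a ⁻¹ * y₁ ⁻¹))                ≡⟨ cong norm (-‿distribˡ-* _ _) ⟨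
    norm (- (a * y₁ * (a ⁻¹ * y₁ ⁻¹)))                ≡⟨ cong (λ u → norm (- u)) (interchange a y₁ (a ⁻¹) (y₁ ⁻¹)) ⟩
    norm (- (a * a ⁻¹ * (y₁ * y₁ ⁻¹)))                ≡⟨ cong (λ u → norm (- u)) (cong₂ _*_ (inverseʳ a a≢0) (inverseʳ y₁ y₁≢0)) ⟩
    norm (- (1# * 1#))                                ≡⟨ cong (λ u → norm (- u)) (*-identityʳ 1#) ⟩
    norm (- 1#)                                       ≡⟨ norm[-1]≡-1 ⟩
    - 1#                                              ∎
    where
    by₂≡-ay₁ : b * y₂ ≡ - (a * y₁)
    by₂≡-ay₁ = +-inverseʳ-unique (a * y₁) (b * y₂) ay₁+by₂≡0

  InPencil⇒ : ∀ {X ℓ} → Generic X → InPencil X ℓ → Generic ℓ × normRatio ℓ * normRatio X ≡ - 1#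
  InPencil⇒ {X} {a , b , c} gX (ℓ≢0 , (y₁ , y₂ , _) , Y∈sls , ℓ∋T , ℓ∋Y) with to (InSls⇔ gX) Y∈sls
  ... | (refl , y₁≢0 , y₂≢0) , κY≡κX = (c≡0 , a≢0 , b≢0) , κℓκX≡-1
    where
    c≡0 : c ≡ 0#
    c≡0 = begin
      c                             ≡⟨ *-identityʳ c ⟨
      c * 1#                        ≡⟨ +-identityˡ _ ⟨
      0# + c * 1#                   ≡⟨ cong (_+ c * 1#) (trans (cong₂ _+_ (zeroʳ a) (zeroʳ b)) (+-identityʳ 0#)) ⟨
      (a * 0# + b * 0#) + c * 1#    ≡⟨ ℓ∋T ⟩
      0#                            ∎
    ay₁+by₂≡0 : a * y₁ + b * y₂ ≡ 0#
    ay₁+by₂≡0 = trans (sym (trans (cong (a * y₁ + b * y₂ +_) (zeroʳ c)) (+-identityʳ _))) ℓ∋Y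
    a≢0 : a ≢ 0#
    a≢0 a≡0 = ℓ≢0 (cong₂ _,_ a≡0 (cong₂ _,_ b≡0 c≡0))
      where
      b≡0 : b ≡ 0#
      b≡0 = *-cancelʳ y₂≢0 (begin
        b * y₂              ≡⟨ +-identityˡ _ ⟨
        0# + b * y₂         ≡⟨ cong (λ u → u + b * y₂) (trans (cong (_* y₁) a≡0) (zeroˡ y₁)) ⟨
        a * y₁ + b * y₂     ≡⟨ ay₁+by₂≡0 ⟩
        0#                  ≡⟨ zeroˡ y₂ ⟨
        0# * y₂             ∎)
    b≢0 : b ≢ 0#
    b≢0 b≡0 = a≢0 (*-cancelʳ y₁≢0 (begin
      a * y₁              ≡⟨ +-identityʳ _ ⟨
      a * y₁ + 0#         ≡⟨ cong (a * y₁ +_) (trans (cong (_* y₂) b≡0) (zeroˡ y₂)) ⟨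
      a * y₁ + b * y₂     ≡⟨ ay₁+by₂≡0 ⟩
      0#                  ≡⟨ zeroˡ y₁ ⟨
      0# * y₁             ∎))
    κℓκX≡-1 : normRatio (a , b , c) * normRatio X ≡ - 1#
    κℓκX≡-1 = trans (cong (normRatio (a , b , c) *_) (sym κY≡κX)) (incident⇒normRatio*normRatio≡-1 a≢0 y₁≢0 ay₁+by₂≡0)

  lineTX : Triple → Triple
  lineTX (x , y , _) = (y , - x , 0#)

  lineTX∈pencil : ∀ {X} → Generic X → InPencil X (lineTX X)
  lineTX∈pencil {x , y , _} gX@(refl , _ , y≢0) =
    (λ lineTX≡0 → y≢0 (cong proj₁ lineTX≡0)) , (x , y , 0#) , from (InSls⇔ gX) (gX , refl) , lineTX∋T , lineTX∋X
    where
    lineTX∋T : (y * 0# + - x * 0#) + 0# * 1# ≡ 0#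
    lineTX∋T = trans (cong₂ _+_ (trans (cong₂ _+_ (zeroʳ y) (zeroʳ (- x))) (+-identityʳ 0#)) (zeroˡ 1#)) (+-identityʳ 0#)
    lineTX∋X : (y * x + - x * y) + 0# * 0# ≡ 0#
    lineTX∋X = trans (cong₂ _+_ (trans (cong₂ _+_ (*-comm y x) (sym (-‿distribˡ-* x y))) (-‿inverseʳ (x * y))) (zeroˡ 0#)) (+-identityʳ 0#)

  SlsTypeII⇔ : ∀ {X} → Generic X → SlsTypeII X ⇔ normRatio X ≡ - 1#
  SlsTypeII⇔ {X} gX = mk⇔
    (λ all-II → to (PTypeII⇔ gX) (all-II X (from (InSls⇔ gX) (gX , refl))))
    (λ κ≡-1 Y Y∈sls → let gY , κY≡κX = to (InSls⇔ gX) Y∈sls in from (PTypeII⇔ gY) (trans κY≡κX κ≡-1))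

  SlsTypeIII⇔ : ∀ {X} → Generic X → SlsTypeIII X ⇔ normRatio X ≢ - 1#
  SlsTypeIII⇔ {X} gX = mk⇔
    (λ all-III → to (PTypeIII⇔ gX) (all-III X (from (InSls⇔ gX) (gX , refl))))
    (λ κ≢-1 Y Y∈sls → let gY , κY≡κX = to (InSls⇔ gX) Y∈sls in from (PTypeIII⇔ gY) (κ≢-1 ∘ trans (sym κY≡κX)))

  PencilTypeII⇔ : ∀ {X} → Generic X → PencilTypeII X ⇔ normRatio X ≡ 1#
  PencilTypeII⇔ {X} gX = mk⇔
    (λ all-II → let gTX , κTXκX≡-1 = InPencil⇒ gX (lineTX∈pencil gX) in
      to (x*y≡-1⇒[x≡-1⇔y≡1] κTXκX≡-1) (to (LTypeII⇔ gTX) (all-II (lineTX X) (lineTX∈pencil gX))))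
    (λ κ≡1 ℓ ℓ∈pencil → let gℓ , κℓκX≡-1 = InPencil⇒ gX ℓ∈pencil in
      from (LTypeII⇔ gℓ) (from (x*y≡-1⇒[x≡-1⇔y≡1] κℓκX≡-1) κ≡1))

  PencilTypeIII⇔ : ∀ {X} → Generic X → PencilTypeIII X ⇔ normRatio X ≢ 1#
  PencilTypeIII⇔ {X} gX = mk⇔
    (λ all-III κ≡1 → let gTX , κTXκX≡-1 = InPencil⇒ gX (lineTX∈pencil gX) in
      to (LTypeIII⇔ gTX) (all-III (lineTX X) (lineTX∈pencil gX)) (from (x*y≡-1⇒[x≡-1⇔y≡1] κTXκX≡-1) κ≡1))
    (λ κ≢1 ℓ ℓ∈pencil → let gℓ , κℓκX≡-1 = InPencil⇒ gX ℓ∈pencil in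
      from (LTypeIII⇔ gℓ) (κ≢1 ∘ to (x*y≡-1⇒[x≡-1⇔y≡1] κℓκX≡-1)))

  SamePencil⇔ : ∀ {X X′} → Generic X → Generic X′ → SamePencil X X′ ⇔ normRatio X ≡ normRatio X′
  SamePencil⇔ {X} {X′} gX gX′ = mk⇔ same⇒ same⇐
    where
    same⇒ : SamePencil X X′ → normRatio X ≡ normRatio X′
    same⇒ same = *-cancelˡ κTX≢0 (trans κTXκX≡-1 (sym κTXκX′≡-1))
      where
      κTXκX≡-1 : normRatio (lineTX X) * normRatio X ≡ - 1#
      κTXκX≡-1 = proj₂ (InPencil⇒ gX (lineTX∈pencil gX))
      κTXκX′≡-1 : normRatio (lineTX X) * normRatio X′ ≡ - 1#
      κTXκX′≡-1 = proj₂ (InPencil⇒ gX′ (to (same (lineTX X)) (lineTX∈pencil gX)))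
      κTX≢0 : normRatio (lineTX X) ≢ 0#
      κTX≢0 κTX≡0 = -1≢0 (trans (sym κTXκX≡-1) (trans (cong (_* normRatio X) κTX≡0) (zeroˡ _)))
    same⇐ : normRatio X ≡ normRatio X′ → SamePencil X X′
    same⇐ κX≡κX′ ℓ = mk⇔
      (λ (ℓ≢0 , Y , Y∈sls , ℓ∋T , ℓ∋Y) → ℓ≢0 , Y , InSls-transfer gX gX′ κX≡κX′ Y∈sls , ℓ∋T , ℓ∋Y)
      (λ (ℓ≢0 , Y , Y∈sls , ℓ∋T , ℓ∋Y) → ℓ≢0 , Y , InSls-transfer gX′ gX (sym κX≡κX′) Y∈sls , ℓ∋T , ℓ∋Y)

  normRatio[1,u,0]≡norm[u] : ∀ u → normRatio (1# , u , 0#) ≡ norm u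
  normRatio[1,u,0]≡norm[u] u = normRatio-unique {z = 0#} 1≢0 (sym (trans (cong (norm u *_) (1^m≡1 normExponent)) (*-identityʳ (norm u))))

  exactlyPencils : ∀ {P : Triple → Set} (L : List Carrier) → Unique L → L ⊆ μ →
    (∀ X → Generic X → P X ⇔ normRatio X ∈ L) → ExactlyPencils (length L) P
  exactlyPencils {P} L L! L⊆μ P⇔∈L = f , f-good , f-injective , f-covers
    where
    norm-preimage : ∀ i → ∃ λ u → u ≢ 0# × norm u ≡ lookup L i
    norm-preimage i = rootOfUnity⇒norm (proj₂ (∈-filter⁻ (λ y → y ^ (q ∸ 1) ≟ 1#) {xs = elements} (L⊆μ (∈-lookup i))))
    f : Fin (length L) → Triple
    f i = (1# , proj₁ (norm-preimage i) , 0#)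
    generic-f : ∀ i → Generic (f i)
    generic-f i = refl , 1≢0 , proj₁ (proj₂ (norm-preimage i))
    κ-f : ∀ i → normRatio (f i) ≡ lookup L i
    κ-f i = trans (normRatio[1,u,0]≡norm[u] _) (proj₂ (proj₂ (norm-preimage i)))
    f-good : ∀ i → Base (f i) × P (f i)
    f-good i = from (Base⇔Generic (f i)) (generic-f i) , from (P⇔∈L (f i) (generic-f i)) (subst (_∈ L) (sym (κ-f i)) (∈-lookup i))
    f-injective : ∀ i j → SamePencil (f i) (f j) → i ≡ j
    f-injective i j same = Unique⇒lookup-injective L! i j
      (trans (sym (κ-f i)) (trans (to (SamePencil⇔ (generic-f i) (generic-f j)) same) (κ-f j)))
    f-covers : ∀ X → Base X → P X → ∃ λ i → SamePencil X (f i)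
    f-covers X bX pX = index κX∈L , from (SamePencil⇔ gX (generic-f _)) (trans (lookup-index κX∈L) (sym (κ-f _)))
      where
      gX : Generic X
      gX = to (Base⇔Generic X) bX
      κX∈L : normRatio X ∈ L
      κX∈L = to (P⇔∈L X gX) pX

  1∈μ : 1# ∈ μ
  1∈μ = subst (_∈ μ) (1^m≡1 normExponent) (norm∈μ 1≢0)

  -1∈μ : - 1# ∈ μ
  -1∈μ = subst (_∈ μ) norm[-1]≡-1 (norm∈μ -1≢0)

  μ∖1 : List Carrier
  μ∖1 = filter (∁? (_≟ 1#)) μ

  length-μ∖1 : length μ∖1 ≡ q ∸ 2
  length-μ∖1 = trans (length-filter-≢ μ-unique 1∈μ) (trans (cong (_∸ 1) length-μ) (ℕ.∸-+-assoc q 1 1))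

  exactlyPencilsTypeII : ExactlyPencils 1 PencilTypeII
  exactlyPencilsTypeII = subst (λ m → ExactlyPencils m PencilTypeII) (length-filter-≟ μ-unique 1∈μ)
    (exactlyPencils (filter (_≟ 1#) μ) (Unique.filter⁺ (_≟ 1#) μ-unique) (filter-⊆ (_≟ 1#) μ)
      (λ X gX → ⇔-sym (∈-filter⇔ (_≟ 1#) (normRatio∈μ gX)) ⇔-∘ PencilTypeII⇔ gX))

  exactlyPencilsTypeIII : ExactlyPencils (q ∸ 2) PencilTypeIII
  exactlyPencilsTypeIII = subst (λ m → ExactlyPencils m PencilTypeIII) length-μ∖1
    (exactlyPencils μ∖1 (Unique.filter⁺ (∁? (_≟ 1#)) μ-unique) (filter-⊆ (∁? (_≟ 1#)) μ)
      (λ X gX → ⇔-sym (∈-filter⇔ (∁? (_≟ 1#)) (normRatio∈μ gX)) ⇔-∘ PencilTypeIII⇔ gX))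

  module _ (-1≡1 : - 1# ≡ 1#) where

    PencilTypeII⇒SlsTypeII : ∀ X → Base X → PencilTypeII X → SlsTypeII X
    PencilTypeII⇒SlsTypeII X bX typeII =
      from (SlsTypeII⇔ gX) (trans (to (PencilTypeII⇔ gX) typeII) (sym -1≡1))
      where
      gX : Generic X
      gX = to (Base⇔Generic X) bX

    PencilTypeIII⇒SlsTypeIII : ∀ X → Base X → PencilTypeIII X → SlsTypeIII X
    PencilTypeIII⇒SlsTypeIII X bX typeIII =
      from (SlsTypeIII⇔ gX) (to (PencilTypeIII⇔ gX) typeIII ∘ flip trans -1≡1)
      where
      gX : Generic X
      gX = to (Base⇔Generic X) bX

  module _ (-1≢1 : - 1# ≢ 1#) where

    PencilTypeII⇒SlsTypeIII : ∀ X → Base X → PencilTypeII X → SlsTypeIII X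
    PencilTypeII⇒SlsTypeIII X bX typeII =
      from (SlsTypeIII⇔ gX) (λ κ≡-1 → -1≢1 (trans (sym κ≡-1) (to (PencilTypeII⇔ gX) typeII)))
      where
      gX : Generic X
      gX = to (Base⇔Generic X) bX

    PencilTypeIII×SlsTypeII⇔ : ∀ {X} → Generic X → (PencilTypeIII X × SlsTypeII X) ⇔ normRatio X ≡ - 1#
    PencilTypeIII×SlsTypeII⇔ gX = mk⇔ (λ (_ , slsII) → to (SlsTypeII⇔ gX) slsII)
      (λ κ≡-1 → from (PencilTypeIII⇔ gX) (λ κ≡1 → -1≢1 (trans (sym κ≡-1) κ≡1)) , from (SlsTypeII⇔ gX) κ≡-1)

    exactlyPencilsTypeIII×SlsTypeII : ExactlyPencils 1 (λ X → PencilTypeIII X × SlsTypeII X)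
    exactlyPencilsTypeIII×SlsTypeII =
      subst (λ m → ExactlyPencils m (λ X → PencilTypeIII X × SlsTypeII X)) (length-filter-≟ μ-unique -1∈μ)
        (exactlyPencils (filter (_≟ - 1#) μ) (Unique.filter⁺ (_≟ - 1#) μ-unique) (filter-⊆ (_≟ - 1#) μ)
          (λ X gX → ⇔-sym (∈-filter⇔ (_≟ - 1#) (normRatio∈μ gX)) ⇔-∘ PencilTypeIII×SlsTypeII⇔ gX))

    μ∖±1 : List Carrier
    μ∖±1 = filter (∁? (_≟ - 1#)) μ∖1

    length-μ∖±1 : length μ∖±1 ≡ q ∸ 3
    length-μ∖±1 = trans (length-filter-≢ (Unique.filter⁺ (∁? (_≟ 1#)) μ-unique) (∈-filter⁺ (∁? (_≟ 1#)) -1∈μ -1≢1))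
      (trans (cong (_∸ 1) length-μ∖1) (ℕ.∸-+-assoc q 2 1))

    PencilTypeIII×SlsTypeIII⇔ : ∀ {X} → Generic X → (PencilTypeIII X × SlsTypeIII X) ⇔ normRatio X ∈ μ∖±1
    PencilTypeIII×SlsTypeIII⇔ gX = mk⇔
      (λ (κ≢1 , κ≢-1) → ∈-filter⁺ (∁? (_≟ - 1#)) (∈-filter⁺ (∁? (_≟ 1#)) (normRatio∈μ gX) κ≢1) κ≢-1)
      (λ κ∈μ∖±1 → let κ∈μ∖1 , κ≢-1 = ∈-filter⁻ (∁? (_≟ - 1#)) {xs = μ∖1} κ∈μ∖±1 in
        proj₂ (∈-filter⁻ (∁? (_≟ 1#)) {xs = μ} κ∈μ∖1) , κ≢-1)
      ⇔-∘ (PencilTypeIII⇔ gX ×-⇔ SlsTypeIII⇔ gX)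

    exactlyPencilsTypeIII×SlsTypeIII : ExactlyPencils (q ∸ 3) (λ X → PencilTypeIII X × SlsTypeIII X)
    exactlyPencilsTypeIII×SlsTypeIII =
      subst (λ m → ExactlyPencils m (λ X → PencilTypeIII X × SlsTypeIII X)) length-μ∖±1
        (exactlyPencils μ∖±1 (Unique.filter⁺ (∁? (_≟ - 1#)) (Unique.filter⁺ (∁? (_≟ 1#)) μ-unique))
          (filter-⊆ (∁? (_≟ 1#)) μ ∘ filter-⊆ (∁? (_≟ - 1#)) μ∖1) (λ X → PencilTypeIII×SlsTypeIII⇔))

-- The only use of the prime-power hypothesis: the field of order q ^ 3 provides everything else.
2≤q : ∀ {q} → IsPrimePower q → 2 ≤ q
2≤q (p , suc k , p-prime , _ , refl) = ℕ.≤-trans (nonTrivial⇒n>1 p) (ℕ.m≤m*n p (p ℕ.^ k))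
  where
  instance
    p-nonTrivial : NonTrivial p
    p-nonTrivial = prime⇒nonTrivial p-prime
    p^k-nonZero : NonZero (p ℕ.^ k)
    p^k-nonZero = ℕ.m^n≢0 p k {{nonTrivial⇒nonZero p}}

-- Imported only here: in the modules above, _^_ is the power in the field.
open import Data.Nat using (_^_)

corollary2p4 : (q : ℕ) → IsPrimePower q → (F : FiniteField (q ^ 3)) →
    let open Geometry F q in
    ExactlyPencils 1 PencilTypeII ×
    ExactlyPencils (q ∸ 2) PencilTypeIII ×
    (2 ∣ q →
      (∀ X → Base X → PencilTypeII X → SlsTypeII X) ×
      (∀ X → Base X → PencilTypeIII X → SlsTypeIII X)) ×
    (¬ (2 ∣ q) →
      (∀ X → Base X → PencilTypeII X → SlsTypeIII X) ×
      ExactlyPencils 1 (λ X → PencilTypeIII X × SlsTypeII X) ×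
      ExactlyPencils (q ∸ 3) (λ X → PencilTypeIII X × SlsTypeIII X))
corollary2p4 q q-primePower F =
    exactlyPencilsTypeII ,
    exactlyPencilsTypeIII ,
    (λ 2∣q → let -1≡1 = 2∣q⇒-1≡1 2∣q in
      PencilTypeII⇒SlsTypeII -1≡1 , PencilTypeIII⇒SlsTypeIII -1≡1) ,
    (λ ¬2∣q → let -1≢1 = ¬2∣q⇒-1≢1 ¬2∣q in
      PencilTypeII⇒SlsTypeIII -1≢1 , exactlyPencilsTypeIII×SlsTypeII -1≢1 , exactlyPencilsTypeIII×SlsTypeIII -1≢1)
  where open Pencils q {{n>1⇒nonTrivial (2≤q q-primePower)}} F
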